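{- Let $q>p\ge3$ be coprime integers, let $u$ be the integer with $0\le u<p$ and $uq\equiv1\pmod p$. Let $\langle p,q\rangle=\{iq+jp : i,j\in\mathbb{Z}_{\ge0}\}$, $\vartheta=(p-1)(q-1)/2$, list the elements of $\langle p,q\rangle\cap[0,(p-1)(q-1)]$ increasingly as $\ell_0<\dots<\ell_\vartheta$, and put $S_\Delta(p,q)=\{\ell_{j+1}-\ell_j : 0\le j\le\vartheta-1\}$. Let $D_\Delta(p,u)=\{b-a : (a,b)\in D\}$, where $D$ is the set of integer pairs $(a,b)$, $a<b$, with $\max(\langle ua\rangle_p,\langle ub\rangle_p)<\min_{a<n<b}\langle un\rangle_p$ (vacuous when $b=a+1$). Then $S_\Delta(p,q)\supseteq D_\Delta(p,u)$.
   Context: $\langle x\rangle_p$ denotes the least nonnegative residue of the integer $x$ modulo $p$. -}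

module Defs where

open import Data.Nat as ℕ using (ℕ; _+_; _*_; _∸_; _≤_; _<_; NonZero)
open import Data.Nat using (_⊔_)
open import Data.Integer as ℤ using (ℤ; +_; _%ℕ_)
open import Data.Product using (Σ; ∃; ∃-syntax; _×_)
open import Relation.Binary.PropositionalEquality using (_≡_)
open import Relation.Nullary using (¬_)

InSG : ℕ → ℕ → ℕ → Set
InSG p q n = ∃[ i ] ∃[ j ] (n ≡ i * q + j * p)

SΔ : ℕ → ℕ → ℕ → Set
SΔ p q d = ∃[ x ] ∃[ y ]
  ( InSG p q x × InSG p q y × x < y × y ≤ (p ∸ 1) * (q ∸ 1)
  × (∀ z → x < z → z < y → ¬ InSG p q z)
  × y ∸ x ≡ d )

res : (p : ℕ) .{{_ : NonZero p}} → ℤ → ℕ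
res p x = x %ℕ p

InD : (p u : ℕ) .{{_ : NonZero p}} → ℤ → ℤ → Set
InD p u a b = (a ℤ.< b) ×
  (∀ (n : ℤ) → a ℤ.< n → n ℤ.< b → (res p (+ u ℤ.* a) ⊔ res p (+ u ℤ.* b)) < res p (+ u ℤ.* n))

DΔ : (p u : ℕ) .{{_ : NonZero p}} → ℤ → Set
DΔ p u d = ∃[ a ] ∃[ b ] (InD p u a b × d ≡ b ℤ.- a)

{-# OPTIONS --safe #-}
-- Write ρ m = ⟨u m⟩_p. Since u q ≡ 1 (mod p), ρ m · q ≡ m (mod p) for every m, and an
-- element z = i q + j p of ⟨p,q⟩ has ρ z = ⟨i⟩_p ≤ i, hence ρ z · q ≤ z.
-- Given (a,b) ∈ D with d = b − a, translate a by a multiple of p to make it a natural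
-- number and put α = ρ a, β = ρ b, M = max(α,β). As α q + d ≡ β q (mod p), the larger of
-- the two exceeds the smaller by a multiple of p; this yields x < y = x + d in ⟨p,q⟩ with
-- x ≡ a (mod p) and y ≤ (M+1) q. An element x + k of ⟨p,q⟩ with 0 < k < d would satisfy
-- ρ (x + k) = ρ (a + k) > M, hence x + k ≥ ρ (x + k) · q ≥ (M+1) q ≥ y, which is absurd.
-- It remains to see y ≤ (p−1)(q−1). For d ≥ 2 the residue at a + 1 forces M ≤ p − 2, a
-- multiple of p inside (a,b) would have residue 0, so d ≤ p, and for d ≥ 3 the residues
-- at a + 1 and a + 2 cannot both equal p − 1, so M ≤ p − 3. Every pair (a, a+1) lies in D,
-- and d = 1 is obtained from a = 0 or a = q.
module Submission where

open import Data.Empty using (⊥-elim)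
open import Data.Integer as ℤ using (ℤ; +_; -[1+_]; +<+; ∣_∣; _%ℕ_; _/ℕ_)
open import Data.Integer.DivMod using (a≡a%ℕn+[a/ℕn]*n; n%ℕd<d)
import Data.Integer.Properties as ℤₚ
import Data.Integer.Tactic.RingSolver as ℤRing
open import Data.Nat
open import Data.Nat.Coprimality using (Coprime)
open import Data.Nat.DivMod
open import Data.Nat.Properties
open import Data.Nat.Tactic.RingSolver using (solve-∀)
open import Data.Product using (∃-syntax; _,_; proj₂)
open import Data.Sum using (inj₁; inj₂; [_,_]′)
open import Relation.Binary.PropositionalEquality
open import Relation.Nullary using (¬_; yes; no; contradiction)

open import Defs

%-cong-+ʳ : ∀ {m n} o d .{{_ : NonZero d}} → m % d ≡ n % d → (m + o) % d ≡ (n + o) % d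
%-cong-+ʳ {m} {n} o d eq = begin
  (m + o) % d            ≡⟨ %-distribˡ-+ m o d ⟩
  (m % d + o % d) % d    ≡⟨ cong (λ t → (t + o % d) % d) eq ⟩
  (n % d + o % d) % d    ≡⟨ %-distribˡ-+ n o d ⟨
  (n + o) % d            ∎
  where open ≡-Reasoning

%-cong-*ˡ : ∀ {m n} o d .{{_ : NonZero d}} → m % d ≡ n % d → (o * m) % d ≡ (o * n) % d
%-cong-*ˡ {m} {n} o d eq = begin
  (o * m) % d              ≡⟨ %-distribˡ-* o m d ⟩
  (o % d * (m % d)) % d    ≡⟨ cong (λ t → (o % d * t) % d) eq ⟩
  (o % d * (n % d)) % d    ≡⟨ %-distribˡ-* o n d ⟨
  (o * n) % d              ∎
  where open ≡-Reasoning

%-cong-*ʳ : ∀ {m n} o d .{{_ : NonZero d}} → m % d ≡ n % d → (m * o) % d ≡ (n * o) % d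
%-cong-*ʳ {m} {n} o d eq =
  subst₂ (λ s t → s % d ≡ t % d) (*-comm o m) (*-comm o n) (%-cong-*ˡ o d eq)

m%n≡o%n⇒∃[k]o≡m+k*n : ∀ {m o n} .{{_ : NonZero n}} →
                      m % n ≡ o % n → m ≤ o → ∃[ k ] o ≡ m + k * n
m%n≡o%n⇒∃[k]o≡m+k*n {m} {o} {n} eq m≤o = k , (begin
  o                              ≡⟨ m≡m%n+[m/n]*n o n ⟩
  o % n + o / n * n              ≡⟨ cong₂ (λ r s → r + s * n) (sym eq) (sym (m+[n∸m]≡n (/-monoˡ-≤ n m≤o))) ⟩
  m % n + (m / n + k) * n        ≡⟨ cong (_+_ (m % n)) (*-distribʳ-+ n (m / n) k) ⟩
  m % n + (m / n * n + k * n)    ≡⟨ +-assoc (m % n) (m / n * n) (k * n) ⟨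
  m % n + m / n * n + k * n      ≡⟨ cong (_+ k * n) (m≡m%n+[m/n]*n m n) ⟨
  m + k * n                      ∎)
  where
  open ≡-Reasoning
  k = o / n ∸ m / n

m%n≡[1+m]%n⇒n≡1 : ∀ m n .{{_ : NonZero n}} → m % n ≡ suc m % n → n ≡ 1
m%n≡[1+m]%n⇒n≡1 m n eq with m%n≡o%n⇒∃[k]o≡m+k*n eq (n≤1+n m)
... | k , 1+m≡m+k*n =
  m*n≡1⇒n≡1 k n (sym (+-cancelˡ-≡ m 1 (k * n) (trans (+-comm m 1) 1+m≡m+k*n)))

+m≡r+s*p⇒m%p≡r : ∀ {m r p} .{{_ : NonZero p}} (s : ℤ) →
                 r < p → + m ≡ + r ℤ.+ s ℤ.* + p → m % p ≡ r
+m≡r+s*p⇒m%p≡r {m} {r} {p} (+ s) r<p eq = begin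
  m % p            ≡⟨ cong (_% p) (ℤₚ.+-injective (trans eq (cong (ℤ._+_ (+ r)) (sym (ℤₚ.pos-* s p))))) ⟩
  (r + s * p) % p  ≡⟨ [m+kn]%n≡m%n r s p ⟩
  r % p            ≡⟨ m<n⇒m%n≡m r<p ⟩
  r                ∎
  where open ≡-Reasoning
+m≡r+s*p⇒m%p≡r {m} {r} {p} -[1+ s ] r<p eq =
  ⊥-elim (<-irrefl (sym m+[1+s]p≡r) (<-≤-trans r<p (≤-trans (m≤m+n p (s * p)) (m≤n+m _ m))))
  where
  open ≡-Reasoning
  cancel : ∀ x y z → x ℤ.+ y ℤ.* z ℤ.+ ℤ.- y ℤ.* z ≡ x
  cancel = ℤRing.solve-∀
  m+[1+s]p≡r : m + suc s * p ≡ r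
  m+[1+s]p≡r = ℤₚ.+-injective (begin
    + (m + suc s * p)                                  ≡⟨ cong (ℤ._+_ (+ m)) (ℤₚ.pos-* (suc s) p) ⟩
    + m ℤ.+ + suc s ℤ.* + p                            ≡⟨ cong (λ t → t ℤ.+ + suc s ℤ.* + p) eq ⟩
    + r ℤ.+ -[1+ s ] ℤ.* + p ℤ.+ + suc s ℤ.* + p       ≡⟨ cancel (+ r) -[1+ s ] (+ p) ⟩
    + r                                                ∎)

%ℕ-shift : ∀ {p} .{{_ : NonZero p}} i k m → i ℤ.+ + (k * p) ≡ + m → i %ℕ p ≡ m % p
%ℕ-shift {p} i k m eq = sym (+m≡r+s*p⇒m%p≡r (i /ℕ p ℤ.+ + k) (n%ℕd<d i p) (begin
  + m                                             ≡⟨ eq ⟨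
  i ℤ.+ + (k * p)                                 ≡⟨ cong₂ ℤ._+_ (a≡a%ℕn+[a/ℕn]*n i p) (ℤₚ.pos-* k p) ⟩
  + (i %ℕ p) ℤ.+ i /ℕ p ℤ.* + p ℤ.+ + k ℤ.* + p    ≡⟨ regroup (+ (i %ℕ p)) (i /ℕ p) (+ k) (+ p) ⟩
  + (i %ℕ p) ℤ.+ (i /ℕ p ℤ.+ + k) ℤ.* + p          ∎))
  where
  open ≡-Reasoning
  regroup : ∀ r s k p → r ℤ.+ s ℤ.* p ℤ.+ k ℤ.* p ≡ r ℤ.+ (s ℤ.+ k) ℤ.* p
  regroup = ℤRing.solve-∀

∃[n]+n≡i+∣i∣*p : ∀ i p .{{_ : NonZero p}} → ∃[ n ] + n ≡ i ℤ.+ + (∣ i ∣ * p)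
∃[n]+n≡i+∣i∣*p (+ n)    p = n + n * p , refl
∃[n]+n≡i+∣i∣*p -[1+ n ] p = suc n * p ∸ suc n , sym (ℤₚ.⊖-≥ (m≤m*n (suc n) p))

conductor : ℕ → ℕ → ℕ
conductor p q = (p ∸ 1) * (q ∸ 1)

*q+2≤conductor : ∀ {p q α d} → p < q → 2 + α ≤ p → d ≤ 2 → α * q + d ≤ conductor p q
*q+2≤conductor {suc (suc P)} {suc Q} {α} {d} (s≤s p≤Q) (s≤s (s≤s α≤P)) d≤2 = begin
  α * suc Q + d      ≤⟨ +-mono-≤ (*-monoˡ-≤ (suc Q) α≤P) d≤2 ⟩
  P * suc Q + 2      ≡⟨ shuffle P Q ⟩
  P * Q + (2 + P)    ≤⟨ +-monoʳ-≤ (P * Q) p≤Q ⟩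
  P * Q + Q          ≡⟨ +-comm (P * Q) Q ⟩
  suc P * Q          ∎
  where
  open ≤-Reasoning
  shuffle : ∀ P Q → P * suc Q + 2 ≡ P * Q + (2 + P)
  shuffle = solve-∀

*q+p≤conductor : ∀ {p q α d} → p < q → 3 + α ≤ p → d ≤ p → α * q + d ≤ conductor p q
*q+p≤conductor {suc (suc (suc P))} {suc Q} {α} {d} (s≤s p≤Q) (s≤s (s≤s (s≤s α≤P))) d≤p = begin
  α * suc Q + d            ≤⟨ +-mono-≤ (*-monoˡ-≤ (suc Q) α≤P) d≤p ⟩
  P * suc Q + (3 + P)      ≡⟨ shuffle P Q ⟩
  P * Q + (3 + P) + P      ≤⟨ +-mono-≤ (+-monoʳ-≤ (P * Q) p≤Q) (≤-trans (m≤n+m P 3) p≤Q) ⟩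
  P * Q + Q + Q            ≡⟨ shuffle′ P Q ⟩
  (2 + P) * Q              ∎
  where
  open ≤-Reasoning
  shuffle : ∀ P Q → P * suc Q + (3 + P) ≡ P * Q + (3 + P) + P
  shuffle = solve-∀
  shuffle′ : ∀ P Q → P * Q + Q + Q ≡ (2 + P) * Q
  shuffle′ = solve-∀

SΔ-intro : ∀ {p q x d} → InSG p q x → InSG p q (x + d) → 0 < d → x + d ≤ conductor p q →
           (∀ k → 0 < k → k < d → ¬ InSG p q (x + k)) → SΔ p q d
SΔ-intro {p} {q} {x} {d} x∈ x+d∈ 0<d x+d≤c gap =
  x , x + d , x∈ , x+d∈ , m<m+n x 0<d , x+d≤c , between , m+n∸m≡n x d
  where
  between : ∀ z → x < z → z < x + d → ¬ InSG p q z
  between z x<z z<x+d = subst (λ z → ¬ InSG p q z) x+[z∸x]≡z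
    (gap (z ∸ x) (m<n⇒0<n∸m x<z) (+-cancelˡ-< x _ _ (subst (_< x + d) (sym x+[z∸x]≡z) z<x+d)))
    where
    x+[z∸x]≡z : x + (z ∸ x) ≡ z
    x+[z∸x]≡z = m+[n∸m]≡n (<⇒≤ x<z)

module Residues (p u : ℕ) .{{_ : NonZero p}} where

  ρ : ℕ → ℕ
  ρ m = (u * m) % p

  ρ<p : ∀ m → ρ m < p
  ρ<p m = m%n<n (u * m) p

  ρ-cong : ∀ {m n} → m % p ≡ n % p → ρ m ≡ ρ n
  ρ-cong = %-cong-*ˡ u p

  ρ-+ : ∀ m n → ρ (m + n) ≡ (ρ m + ρ n) % p
  ρ-+ m n = trans (cong (_% p) (*-distribˡ-+ u m n)) (%-distribˡ-+ (u * m) (u * n) p)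

  ρ[k*p]≡0 : ∀ k → ρ (k * p) ≡ 0
  ρ[k*p]≡0 k = trans (cong (_% p) (sym (*-assoc u k p))) (m*n%n≡0 (u * k) p)

  ρ-ends : ℕ → ℕ → ℕ
  ρ-ends a d = ρ a ⊔ ρ (a + d)

  -- (a, a + d) ∈ D(p,u) for a ∈ ℕ, quantifying over the offsets k = n − a.
  InD⁺ : ℕ → ℕ → Set
  InD⁺ a d = ∀ k → 0 < k → k < d → ρ-ends a d < ρ (a + k)

  InD⁺-1 : ∀ a → InD⁺ a 1
  InD⁺-1 _ (suc _) _ (s≤s ())

  InD⁺⇒2+ρ-ends≤p : ∀ {a d} → InD⁺ a d → 2 ≤ d → 2 + ρ-ends a d ≤ p
  InD⁺⇒2+ρ-ends≤p {a} gap 2≤d = ≤-trans (s≤s (gap 1 z<s 2≤d)) (ρ<p (a + 1))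

  InD⁺⇒d≤p : ∀ {a d} → InD⁺ a d → d ≤ p
  InD⁺⇒d≤p {a} {d} gap with d ≤? p
  ... | yes d≤p = d≤p
  ... | no d≰p = ⊥-elim (n≮0 (subst (ρ-ends a d <_) ρ[a+k]≡0 (gap k 0<k k<d)))
    where
    open ≡-Reasoning
    -- a + k is the least multiple of p above a.
    k = p ∸ a % p
    0<k : 0 < k
    0<k = m<n⇒0<n∸m (m%n<n a p)
    k<d : k < d
    k<d = ≤-<-trans (m∸n≤m p (a % p)) (≰⇒> d≰p)
    ρ[a+k]≡0 : ρ (a + k) ≡ 0
    ρ[a+k]≡0 = begin
      ρ (a + k)                        ≡⟨ cong (λ t → ρ (t + k)) (trans (m≡m%n+[m/n]*n a p) (+-comm (a % p) _)) ⟩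
      ρ (a / p * p + a % p + k)        ≡⟨ cong ρ (+-assoc (a / p * p) (a % p) k) ⟩
      ρ (a / p * p + (a % p + k))      ≡⟨ cong (λ t → ρ (a / p * p + t)) (m+[n∸m]≡n (<⇒≤ (m%n<n a p))) ⟩
      ρ (a / p * p + p)                ≡⟨ cong ρ (+-comm (a / p * p) p) ⟩
      ρ (suc (a / p) * p)              ≡⟨ ρ[k*p]≡0 (suc (a / p)) ⟩
      0                                ∎

  res[u*i]≡ρm : ∀ K i m → i ℤ.+ + (K * p) ≡ + m → res p (+ u ℤ.* i) ≡ ρ m
  res[u*i]≡ρm K i m eq = %ℕ-shift (+ u ℤ.* i) (u * K) (u * m) (begin
    + u ℤ.* i ℤ.+ + (u * K * p)         ≡⟨ cong (ℤ._+_ (+ u ℤ.* i)) (trans (cong +_ (*-assoc u K p)) (ℤₚ.pos-* u (K * p))) ⟩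
    + u ℤ.* i ℤ.+ + u ℤ.* + (K * p)     ≡⟨ ℤₚ.*-distribˡ-+ (+ u) i (+ (K * p)) ⟨
    + u ℤ.* (i ℤ.+ + (K * p))           ≡⟨ cong (+ u ℤ.*_) eq ⟩
    + u ℤ.* + m                         ≡⟨ ℤₚ.pos-* u m ⟨
    + (u * m)                           ∎)
    where open ≡-Reasoning

  InD⇒InD⁺ : ∀ {a b d} → InD p u a b → + d ≡ b ℤ.- a → ∃[ a₀ ] InD⁺ a₀ d
  InD⇒InD⁺ {a} {b} {d} (_ , gap) d≡b-a with ∃[n]+n≡i+∣i∣*p a p
  ... | a₀ , a₀≡a+N = a₀ , λ k 0<k k<d →
    subst₂ _<_ (cong₂ _⊔_ (ρ-shift a a₀ (sym a₀≡a+N)) (ρ-shift b (a₀ + d) b+N≡a₀+d))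
               (ρ-shift (a ℤ.+ + k) (a₀ + k) (a+k+N≡a₀+k k))
               (gap (a ℤ.+ + k) (a<a+k 0<k) (a+k<b k<d))
    where
    N = ∣ a ∣ * p
    ρ-shift = res[u*i]≡ρm ∣ a ∣
    a+k+N≡a₀+k : ∀ k → a ℤ.+ + k ℤ.+ + N ≡ + (a₀ + k)
    a+k+N≡a₀+k k = trans (swap a (+ k) (+ N)) (cong (ℤ._+ + k) (sym a₀≡a+N))
      where
      swap : ∀ x y z → x ℤ.+ y ℤ.+ z ≡ x ℤ.+ z ℤ.+ y
      swap = ℤRing.solve-∀
    b≡a+d : b ≡ a ℤ.+ + d
    b≡a+d = trans (split a b) (cong (ℤ._+_ a) (sym d≡b-a))
      where
      split : ∀ x y → y ≡ x ℤ.+ (y ℤ.- x)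
      split = ℤRing.solve-∀
    b+N≡a₀+d : b ℤ.+ + N ≡ + (a₀ + d)
    b+N≡a₀+d = trans (cong (ℤ._+ + N) b≡a+d) (a+k+N≡a₀+k d)
    a<a+k : ∀ {k} → 0 < k → a ℤ.< a ℤ.+ + k
    a<a+k {k} 0<k = subst (ℤ._< a ℤ.+ + k) (ℤₚ.+-identityʳ a) (ℤₚ.+-monoʳ-< a (+<+ 0<k))
    a+k<b : ∀ {k} → k < d → a ℤ.+ + k ℤ.< b
    a+k<b k<d = subst (_ ℤ.<_) (sym b≡a+d) (ℤₚ.+-monoʳ-< a (+<+ k<d))

  InD⇒0<d : ∀ {a b d} → InD p u a b → + d ≡ b ℤ.- a → 0 < d
  InD⇒0<d {a} (a<b , _) d≡b-a =
    ℤₚ.drop‿+<+ (subst₂ ℤ._<_ (ℤₚ.+-inverseʳ a) (sym d≡b-a) (ℤₚ.+-monoˡ-< (ℤ.- a) a<b))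

  module Inverse (q : ℕ) (uq≡1 : (u * q) % p ≡ 1) where

    ρ[m*q]≡m%p : ∀ m → ρ (m * q) ≡ m % p
    ρ[m*q]≡m%p m = begin
      (u * (m * q)) % p    ≡⟨ cong (λ t → (u * t) % p) (*-comm m q) ⟩
      (u * (q * m)) % p    ≡⟨ cong (_% p) (*-assoc u q m) ⟨
      (u * q * m) % p      ≡⟨ %-cong-*ʳ m p (trans (sym (m%n%n≡m%n (u * q) p)) (cong (_% p) uq≡1)) ⟩
      (1 * m) % p          ≡⟨ cong (_% p) (*-identityˡ m) ⟩
      m % p                ∎
      where open ≡-Reasoning

    [ρm*q]%p≡m%p : ∀ m → (ρ m * q) % p ≡ m % p
    [ρm*q]%p≡m%p m = begin
      (ρ m * q) % p      ≡⟨ %-cong-*ʳ q p (m%n%n≡m%n (u * m) p) ⟩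
      (u * m * q) % p    ≡⟨ cong (_% p) (*-assoc u m q) ⟩
      ρ (m * q)          ≡⟨ ρ[m*q]≡m%p m ⟩
      m % p              ∎
      where open ≡-Reasoning

    ρm≡ρn⇒m%p≡n%p : ∀ {m n} → ρ m ≡ ρ n → m % p ≡ n % p
    ρm≡ρn⇒m%p≡n%p {m} {n} eq =
      trans (sym ([ρm*q]%p≡m%p m)) (trans (cong (λ t → (t * q) % p) eq) ([ρm*q]%p≡m%p n))

    InSG⇒ρ*q≤ : ∀ {z} → InSG p q z → ρ z * q ≤ z
    InSG⇒ρ*q≤ (i , j , refl) = begin
      ρ (i * q + j * p) * q  ≡⟨ cong (_* q) (trans (ρ-cong ([m+kn]%n≡m%n (i * q) j p)) (ρ[m*q]≡m%p i)) ⟩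
      i % p * q              ≤⟨ *-monoˡ-≤ q (m%n≤m i p) ⟩
      i * q                  ≤⟨ m≤m+n (i * q) (j * p) ⟩
      i * q + j * p          ∎
      where open ≤-Reasoning

    InD⁺⇒3+ρ-ends≤p : ∀ {a d} → InD⁺ a d → 3 ≤ d → 3 + ρ-ends a d ≤ p
    InD⁺⇒3+ρ-ends≤p {a} {d} gap 3≤d with m≤n⇒m<n∨m≡n (InD⁺⇒2+ρ-ends≤p gap (≤-trans (n≤1+n 2) 3≤d))
    ... | inj₁ 3+M≤p = 3+M≤p
    ... | inj₂ 2+M≡p = contradiction (trans 2+M≡p p≡1) λ ()
      where
      pinned : ∀ k → 0 < k → k < d → ρ (a + k) ≡ suc (ρ-ends a d)
      pinned k 0<k k<d = ≤-antisym (≤-pred (subst (ρ (a + k) <_) (sym 2+M≡p) (ρ<p (a + k)))) (gap k 0<k k<d)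
      ρ[a+1]≡ρ[a+2] : ρ (a + 1) ≡ ρ (a + 2)
      ρ[a+1]≡ρ[a+2] = trans (pinned 1 z<s (≤-trans (n≤1+n 2) 3≤d)) (sym (pinned 2 z<s 3≤d))
      p≡1 : p ≡ 1
      p≡1 = m%n≡[1+m]%n⇒n≡1 (a + 1) p
              (subst (λ t → (a + 1) % p ≡ t % p) (+-suc a 1) (ρm≡ρn⇒m%p≡n%p ρ[a+1]≡ρ[a+2]))

    InD⁺⇒¬InSG : ∀ {a d x} → InD⁺ a d → x % p ≡ a % p → x + d ≤ suc (ρ-ends a d) * q →
                 ∀ k → 0 < k → k < d → ¬ InSG p q (x + k)
    InD⁺⇒¬InSG {a} {d} {x} gap x≡a x+d≤ k 0<k k<d x+k∈ = <-irrefl refl (begin-strict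
      suc (ρ-ends a d) * q   ≤⟨ *-monoˡ-≤ q (subst (ρ-ends a d <_) ρ[a+k]≡ρ[x+k] (gap k 0<k k<d)) ⟩
      ρ (x + k) * q          ≤⟨ InSG⇒ρ*q≤ x+k∈ ⟩
      x + k                  <⟨ +-monoʳ-< x k<d ⟩
      x + d                  ≤⟨ x+d≤ ⟩
      suc (ρ-ends a d) * q   ∎)
      where
      open ≤-Reasoning
      ρ[a+k]≡ρ[x+k] : ρ (a + k) ≡ ρ (x + k)
      ρ[a+k]≡ρ[x+k] = ρ-cong (%-cong-+ʳ k p (sym x≡a))

    InD⁺⇒SΔ-bounded : ∀ {a d} → InD⁺ a d → 0 < d → d ≤ q →
                      ρ a * q + d ≤ conductor p q → ρ (a + d) * q ≤ conductor p q → SΔ p q d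
    InD⁺⇒SΔ-bounded {a} {d} gap 0<d d≤q αq+d≤c βq≤c = [ below , above ]′ (≤-total (β * q) (α * q + d))
      where
      α = ρ a
      β = ρ (a + d)
      αq+d≡βq : (α * q + d) % p ≡ (β * q) % p
      αq+d≡βq = trans (%-cong-+ʳ d p ([ρm*q]%p≡m%p a)) (sym ([ρm*q]%p≡m%p (a + d)))
      consecutive : ∀ x → InSG p q x → InSG p q (x + d) → x % p ≡ a % p →
                    x + d ≤ suc (ρ-ends a d) * q → x + d ≤ conductor p q → SΔ p q d
      consecutive x x∈ x+d∈ x≡a x+d≤ x+d≤c = SΔ-intro x∈ x+d∈ 0<d x+d≤c (InD⁺⇒¬InSG gap x≡a x+d≤)
      below : β * q ≤ α * q + d → SΔ p q d
      below βq≤αq+d with m%n≡o%n⇒∃[k]o≡m+k*n (sym αq+d≡βq) βq≤αq+d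
      ... | j , αq+d≡βq+jp =
        consecutive (α * q) (α , 0 , sym (+-identityʳ (α * q))) (β , j , αq+d≡βq+jp) ([ρm*q]%p≡m%p a)
          (≤-trans (+-mono-≤ (*-monoˡ-≤ q (m≤m⊔n α β)) d≤q) (≤-reflexive (+-comm (ρ-ends a d * q) q)))
          αq+d≤c
      above : α * q + d ≤ β * q → SΔ p q d
      above αq+d≤βq with m%n≡o%n⇒∃[k]o≡m+k*n αq+d≡βq αq+d≤βq
      ... | j , βq≡αq+d+jp =
        consecutive (α * q + j * p) (α , j , refl) (β , 0 , trans x+d≡βq (sym (+-identityʳ (β * q))))
          (trans ([m+kn]%n≡m%n (α * q) j p) ([ρm*q]%p≡m%p a))
          (≤-trans (≤-reflexive x+d≡βq) (≤-trans (*-monoˡ-≤ q (m≤n⊔m α β)) (m≤n+m _ q)))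
          (subst (_≤ conductor p q) (sym x+d≡βq) βq≤c)
        where
        swap : ∀ x y z → x + y + z ≡ x + z + y
        swap = solve-∀
        x+d≡βq : α * q + j * p + d ≡ β * q
        x+d≡βq = trans (swap (α * q) (j * p) d) (sym βq≡αq+d+jp)

    SΔ-1 : 3 ≤ p → p < q → SΔ p q 1
    SΔ-1 3≤p p<q with 2 + ρ 1 ≤? p
    ... | yes 2+ρ1≤p =
      InD⁺⇒SΔ-bounded (InD⁺-1 0) z<s (≤-trans (s≤s z≤n) p<q)
        (*q+2≤conductor p<q (≤-trans (+-monoʳ-≤ 2 (≤-reflexive (ρ[k*p]≡0 0))) 2≤p) (s≤s z≤n))
        (≤-trans (m≤m+n (ρ 1 * q) 0) (*q+2≤conductor p<q 2+ρ1≤p z≤n))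
      where
      2≤p = ≤-trans (n≤1+n 2) 3≤p
    ... | no 2+ρ1≰p =
      InD⁺⇒SΔ-bounded (InD⁺-1 q) z<s (≤-trans (s≤s z≤n) p<q)
        (*q+2≤conductor p<q (subst (λ α → 2 + α ≤ p) (sym uq≡1) 3≤p) (s≤s z≤n))
        (subst (λ β → β * q ≤ conductor p q) (sym ρ[q+1]≡0) z≤n)
      where
      open ≡-Reasoning
      ρ[q+1]≡0 : ρ (q + 1) ≡ 0
      ρ[q+1]≡0 = begin
        ρ (q + 1)          ≡⟨ ρ-+ q 1 ⟩
        (ρ q + ρ 1) % p    ≡⟨ cong (λ t → (t + ρ 1) % p) uq≡1 ⟩
        suc (ρ 1) % p      ≡⟨ cong (_% p) (≤-antisym (ρ<p 1) (≤-pred (≰⇒> 2+ρ1≰p))) ⟩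
        p % p              ≡⟨ n%n≡0 p ⟩
        0                  ∎

    InD⁺⇒SΔ₂ : p < q → ∀ {a d} → InD⁺ a d → 2 ≤ d → SΔ p q d
    InD⁺⇒SΔ₂ p<q {a} {d} gap 2≤d =
      InD⁺⇒SΔ-bounded gap (≤-trans (n≤1+n 1) 2≤d) (≤-trans d≤p (<⇒≤ p<q)) αq+d≤c βq≤c
      where
      d≤p = InD⁺⇒d≤p gap
      2+M≤p = InD⁺⇒2+ρ-ends≤p gap 2≤d
      βq≤c : ρ (a + d) * q ≤ conductor p q
      βq≤c = ≤-trans (m≤m+n _ 0) (*q+2≤conductor p<q (≤-trans (+-monoʳ-≤ 2 (m≤n⊔m (ρ a) _)) 2+M≤p) z≤n)
      αq+d≤c : ρ a * q + d ≤ conductor p q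
      αq+d≤c with m≤n⇒m<n∨m≡n 2≤d
      ... | inj₁ 3≤d = *q+p≤conductor p<q 3+α≤p d≤p
        where
        3+α≤p = ≤-trans (+-monoʳ-≤ 3 (m≤m⊔n (ρ a) _)) (InD⁺⇒3+ρ-ends≤p gap 3≤d)
      ... | inj₂ 2≡d = *q+2≤conductor p<q 2+α≤p (≤-reflexive (sym 2≡d))
        where
        2+α≤p = ≤-trans (+-monoʳ-≤ 2 (m≤m⊔n (ρ a) _)) 2+M≤p

    InD⁺⇒SΔ : 3 ≤ p → p < q → ∀ {a d} → InD⁺ a d → 0 < d → SΔ p q d
    InD⁺⇒SΔ 3≤p p<q {d = 1}           _   _ = SΔ-1 3≤p p<q
    InD⁺⇒SΔ 3≤p p<q {d = suc (suc _)} gap _ = InD⁺⇒SΔ₂ p<q gap (s≤s (s≤s z≤n))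

-- Only u q ≡ 1 (mod p) is used: it already implies that p and q are coprime, and u need
-- not be reduced modulo p.
lemma15 : (p q u : ℕ) .{{_ : NonZero p}} → 3 ≤ p → p < q → Coprime p q →
    u < p → (u * q) % p ≡ 1 →
    (d : ℕ) → DΔ p u (+ d) → SΔ p q d
lemma15 p q u 3≤p p<q _ _ uq≡1 d (a , b , inD , d≡b-a) =
  InD⁺⇒SΔ 3≤p p<q (proj₂ (InD⇒InD⁺ inD d≡b-a)) (InD⇒0<d inD d≡b-a)
  where
  open Residues p u
  open Inverse q uq≡1
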